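{- Let $B$ be a nontrivial Boolean algebra and $f,g$ modal operators on $B$ such that $f(x)+g(x)=1$ for all $x\neq 0$. Let $F,G$ be ultrafilters of $B$. If $f[G]\not\subseteq F$, then $g[G]\subseteq F$.
   Context: A modal operator on $B$ is a map $f:B\to B$ with $f(0)=0$ and $f(x+y)=f(x)+f(y)$. $f[G]=\{f(a):a\in G\}$. -}

module Defs where

open import Level using (Level; _⊔_; suc)
open import Algebra.Lattice.Bundles using (BooleanAlgebra)
open import Relation.Unary using (Pred; _∈_; _∉_; _⊆_)
open import Relation.Nullary using (¬_)
open import Data.Sum using (_⊎_)

module _ {c ℓ : Level} (B : BooleanAlgebra c ℓ) where
  open BooleanAlgebra B renaming (¬_ to ∁_; ⊥ to 𝟘; ⊤ to 𝟙)

  _≤B_ : Carrier → Carrier → Set ℓ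
  x ≤B y = (x ∧ y) ≈ x

  record IsProperFilter {p : Level} (F : Pred Carrier p) : Set (c ⊔ ℓ ⊔ p) where
    field
      top∈    : 𝟙 ∈ F
      ∧-closed : ∀ {x y} → x ∈ F → y ∈ F → (x ∧ y) ∈ F
      up-closed : ∀ {x y} → x ∈ F → x ≤B y → y ∈ F
      proper  : 𝟘 ∉ F

  record IsUltrafilter {p : Level} (F : Pred Carrier p) : Set (c ⊔ ℓ ⊔ p) where
    field
      isProperFilter : IsProperFilter F
      ultra : ∀ x → x ∈ F ⊎ (∁ x) ∈ F

  record IsModalOperator (f : Carrier → Carrier) : Set (c ⊔ ℓ) where
    field
      cong  : ∀ {x y} → x ≈ y → f x ≈ f y
      f-0   : f 𝟘 ≈ 𝟘
      f-∨   : ∀ x y → f (x ∨ y) ≈ (f x ∨ f y)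

  _[_]⊆_ : {p q : Level} → (Carrier → Carrier) → Pred Carrier p → Pred Carrier q → Set (c ⊔ p ⊔ q)
  f [ G ]⊆ F = ∀ a → a ∈ G → f a ∈ F

module Submission where

open import Defs
open import Level using (Level)
open import Algebra.Lattice.Bundles using (BooleanAlgebra)
open import Relation.Unary using (Pred; _∈_; _∉_)
open import Relation.Nullary using (¬_)
open import Data.Sum using (_⊎_; inj₁; inj₂)
open import Data.Empty using (⊥-elim)
import Algebra.Lattice.Properties.BooleanAlgebra as BooleanAlgebraProperties
import Relation.Binary.Reasoning.Setoid as SetoidReasoning

-- For a, b ∈ G the meet a ∧ b lies in G, so it is nonzero and f(a∧b) ∨ g(a∧b) = 1 ∈ F.
-- F is prime, so f(a∧b) ∈ F or g(a∧b) ∈ F, and monotonicity of f and g gives f a ∈ F or g b ∈ F.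
-- If g b ∉ F for some b ∈ G, the first alternative holds for every a ∈ G, i.e. f[G] ⊆ F.

module _ {c ℓ : Level} (B : BooleanAlgebra c ℓ) where
  open BooleanAlgebra B renaming (¬_ to ∁_; ⊥ to 𝟘; ⊤ to 𝟙)
  open BooleanAlgebraProperties B using (∧-idem; deMorgan₂)
  open SetoidReasoning setoid

  private
    _≤_ : Carrier → Carrier → Set ℓ
    _≤_ = _≤B_ B

  x∧y≤x : ∀ x y → (x ∧ y) ≤ x
  x∧y≤x x y = begin
    (x ∧ y) ∧ x  ≈⟨ ∧-comm _ _ ⟩
    x ∧ (x ∧ y)  ≈⟨ ∧-assoc x x y ⟨
    (x ∧ x) ∧ y  ≈⟨ ∧-congʳ (∧-idem x) ⟩
    x ∧ y        ∎

  x∧y≤y : ∀ x y → (x ∧ y) ≤ y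
  x∧y≤y x y = trans (∧-assoc x y y) (∧-congˡ (∧-idem y))

  ≤⇒≈∨ : ∀ {x y} → x ≤ y → y ≈ x ∨ y
  ≤⇒≈∨ {x} {y} x≤y = begin
    y            ≈⟨ ∨-absorbs-∧ y x ⟨
    y ∨ (y ∧ x)  ≈⟨ ∨-congˡ (∧-comm y x) ⟩
    y ∨ (x ∧ y)  ≈⟨ ∨-congˡ x≤y ⟩
    y ∨ x        ≈⟨ ∨-comm y x ⟩
    x ∨ y        ∎

  modal-monotone : ∀ {h} → IsModalOperator B h → ∀ {x y} → x ≤ y → h x ≤ h y
  modal-monotone {h} isModal {x} {y} x≤y = begin
    h x ∧ h y          ≈⟨ ∧-congˡ (cong (≤⇒≈∨ x≤y)) ⟩
    h x ∧ h (x ∨ y)    ≈⟨ ∧-congˡ (f-∨ x y) ⟩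
    h x ∧ (h x ∨ h y)  ≈⟨ ∧-absorbs-∨ _ _ ⟩
    h x                ∎
    where open IsModalOperator isModal

  module ProperFilter {p : Level} {F : Pred Carrier p} (isFilter : IsProperFilter B F) where
    open IsProperFilter isFilter

    ∈-resp-≈ : ∀ {x y} → x ∈ F → x ≈ y → y ∈ F
    ∈-resp-≈ {x} x∈F x≈y = up-closed x∈F (trans (∧-congˡ (sym x≈y)) (∧-idem x))

    ∈⇒≉𝟘 : ∀ {x} → x ∈ F → ¬ (x ≈ 𝟘)
    ∈⇒≉𝟘 x∈F x≈𝟘 = proper (∈-resp-≈ x∈F x≈𝟘)

    ∁∈⇒∉ : ∀ {x} → ∁ x ∈ F → x ∉ F
    ∁∈⇒∉ {x} ∁x∈F x∈F = proper (∈-resp-≈ (∧-closed x∈F ∁x∈F) (∧-complementʳ x))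

  module Ultrafilter {p : Level} {F : Pred Carrier p} (isUltra : IsUltrafilter B F) where
    open IsUltrafilter isUltra
    open IsProperFilter isProperFilter
    open ProperFilter isProperFilter public

    ∨-prime : ∀ {x y} → (x ∨ y) ∈ F → x ∈ F ⊎ y ∈ F
    ∨-prime {x} {y} x∨y∈F with ultra x | ultra y
    ... | inj₁ x∈F  | _         = inj₁ x∈F
    ... | inj₂ _    | inj₁ y∈F  = inj₂ y∈F
    ... | inj₂ ∁x∈F | inj₂ ∁y∈F =
      ⊥-elim (∁∈⇒∉ (∈-resp-≈ (∧-closed ∁x∈F ∁y∈F) (sym (deMorgan₂ x y))) x∨y∈F)

  module _ {f g : Carrier → Carrier} (f-modal : IsModalOperator B f) (g-modal : IsModalOperator B g)
           (covering : ∀ x → ¬ (x ≈ 𝟘) → (f x ∨ g x) ≈ 𝟙)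
           {p q : Level} {F : Pred Carrier p} {G : Pred Carrier q}
           (F-ultra : IsUltrafilter B F) (G-filter : IsProperFilter B G) where

    private
      module F where
        open Ultrafilter F-ultra public
        open IsProperFilter (IsUltrafilter.isProperFilter F-ultra) public
      module G where
        open ProperFilter G-filter public
        open IsProperFilter G-filter public

    covering-split : ∀ {a b} → a ∈ G → b ∈ G → f a ∈ F ⊎ g b ∈ F
    covering-split {a} {b} a∈G b∈G with F.∨-prime f∨g∈F
      where
      a∧b∈G : (a ∧ b) ∈ G
      a∧b∈G = G.∧-closed a∈G b∈G
      f∨g∈F : (f (a ∧ b) ∨ g (a ∧ b)) ∈ F
      f∨g∈F = F.∈-resp-≈ F.top∈ (sym (covering (a ∧ b) (G.∈⇒≉𝟘 a∧b∈G)))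
    ... | inj₁ fab∈F = inj₁ (F.up-closed fab∈F (modal-monotone f-modal (x∧y≤x a b)))
    ... | inj₂ gab∈F = inj₂ (F.up-closed gab∈F (modal-monotone g-modal (x∧y≤y a b)))

mainTheorem7 : {c ℓ p q : Level} (B : BooleanAlgebra c ℓ) →
    let open BooleanAlgebra B hiding (¬_) in
    ¬ (⊤ ≈ ⊥) →
    (f g : Carrier → Carrier) → IsModalOperator B f → IsModalOperator B g →
    (∀ x → ¬ (x ≈ ⊥) → (f x ∨ g x) ≈ ⊤) →
    (F : Pred Carrier p) (G : Pred Carrier q) →
    IsUltrafilter B F → IsUltrafilter B G →
    ¬ (_[_]⊆_ B f G F) → _[_]⊆_ B g G F
mainTheorem7 B _ f g f-modal g-modal covering F G F-ultra G-ultra f[G]⊈F b b∈G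
  with IsUltrafilter.ultra F-ultra (g b)
... | inj₁ gb∈F  = gb∈F
... | inj₂ ∁gb∈F = ⊥-elim (f[G]⊈F f[G]⊆F)
  where
  f[G]⊆F : _[_]⊆_ B f G F
  f[G]⊆F a a∈G with covering-split B f-modal g-modal covering F-ultra
                      (IsUltrafilter.isProperFilter G-ultra) a∈G b∈G
  ... | inj₁ fa∈F = fa∈F
  ... | inj₂ gb∈F = ⊥-elim (Ultrafilter.∁∈⇒∉ B F-ultra ∁gb∈F gb∈F)
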